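{- Let $g=m\alpha+\beta$ with integers $\alpha\geq 0$ and $0\leq \beta<m$ (and $g\geq 1$). Then the limit $P(g) := \lim_{n\to\infty} P_n(g)$ exists, and \[ P(g)\ = \ \begin{cases} \frac{\beta}{m(m+1)}&\mbox{if $\alpha=0$}\\[2pt] \frac{m+1-\beta}{(m+1)^{\alpha+1}}&\mbox{if $\alpha> 0$.} \end{cases} \]
   Context: Fix an integer $m\geq 1$. For an increasing sequence of positive integers $\{a_n\}_{n=0}^\infty$, partition its terms into bins $b_0=[a_0]$ and $b_k=[a_{m(k-1)+1},a_{m(k-1)+2},\ldots,a_{mk}]$ for $k\geq 1$. A decomposition $z=a_{\ell_t}+\cdots+a_{\ell_1}$ with $\ell_1<\ell_2<\cdots<\ell_t$ is a legal $m$-gonal decomposition if no two summands lie in the same bin. The $m$-gonal sequence is the increasing sequence in which each $a_i$ is the smallest positive integer with no legal $m$-gonal decomposition using $a_0,\ldots,a_{i-1}$; explicitly $a_0=1$ and $a_{km+r}=2r(m+1)^k$ for $k\geq 0$, $1\leq r\leq m$. Every nonnegative integer has a unique legal $m$-gonal decomposition. For $z\in[0,a_{mn+1})$ with legal $m$-gonal decomposition $z=a_{\ell_t}+\cdots+a_{\ell_1}$, $\ell_1<\cdots<\ell_t$, define the multiset of gaps $\mathrm{Gaps}_n(z)=\{\ell_2-\ell_1,\ell_3-\ell_2,\ldots,\ell_t-\ell_{t-1}\}$ (the quantity $\ell_1-0$ is not counted as a gap). Considering all gaps between summands in the legal $m$-gonal decompositions of all $z\in[0,a_{mn+1})$, let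 $P_n(g)$ be the fraction of these gaps that have length $g$. -}

module Defs where

import Data.Nat
open import Data.Nat using (ℕ; zero; suc; _+_; _*_; _∸_; _^_; _≤_; _<_; NonZero; _/_; _%_)
import Data.Nat.Properties as ℕP
open import Data.List using (List; []; _∷_; _++_; map; length; filter; _∷ʳ_; concatMap)
open import Data.Nat.ListAction using (sum)
open import Data.List.Relation.Unary.AllPairs using (AllPairs; allPairs?)
open import Data.Integer using (+_)
open import Data.Rational using (ℚ; 0ℚ; ∣_∣; _-_) renaming (_/_ to _÷_; _<_ to _<ℚ_)
open import Data.Product using (∃-syntax)
open import Relation.Binary.PropositionalEquality using (_≢_)
open import Relation.Nullary.Decidable using (¬?)

-- The m-gonal sequence (0-indexed):  a₀ = 1,  a_{km+r} = 2 r (m+1)^k  for k ≥ 0, 1 ≤ r ≤ m.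
-- For index suc i = km + r we have k = i / m and r = i % m + 1.
a : (m : ℕ) → .{{NonZero m}} → ℕ → ℕ
a m zero    = 1
a m (suc i) = 2 * (i % m + 1) * (suc m ^ (i / m))

-- Bin of the index: b₀ = [a₀], b_k = [a_{m(k-1)+1}, …, a_{mk}] for k ≥ 1.
bin : (m : ℕ) → .{{NonZero m}} → ℕ → ℕ
bin m zero    = 0
bin m (suc i) = suc (i / m)

incLists : ℕ → List (List ℕ)
incLists zero    = [] ∷ []
incLists (suc N) = incLists N ++ map (_∷ʳ N) (incLists N)

Legal : (m : ℕ) → .{{NonZero m}} → List ℕ → Set
Legal m = AllPairs (λ i j → bin m i ≢ bin m j)

value : (m : ℕ) → .{{NonZero m}} → List ℕ → ℕ
value m ls = sum (map (a m) ls)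

-- All legal m-gonal decompositions (as increasing index lists) of all z ∈ [0, a_{mn+1}).
-- Since the sequence is increasing, any summand a_ℓ ≤ z < a_{mn+1} has ℓ ≤ mn,
-- so it suffices to enumerate index sets inside {0, …, mn}.  Each z has exactly one
-- such decomposition (uniqueness), so this is the list of decompositions of all z.
decomps : (m : ℕ) → .{{NonZero m}} → ℕ → List (List ℕ)
decomps m n =
  filter (λ ls → value m ls Data.Nat.<? a m (m * n + 1))
    (filter (allPairs? (λ i j → ¬? (bin m i Data.Nat.≟ bin m j))) (incLists (suc (m * n))))

gaps : List ℕ → List ℕ
gaps (x ∷ y ∷ rest) = (y ∸ x) ∷ gaps (y ∷ rest)
gaps _              = []

allGaps : (m : ℕ) → .{{NonZero m}} → ℕ → List ℕ
allGaps m n = concatMap gaps (decomps m n)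

-- c / t as a rational, with the (irrelevant) convention 0 when t = 0.
ratio : ℕ → ℕ → ℚ
ratio c zero    = 0ℚ
ratio c (suc t) = (+ c) ÷ suc t

P : (m : ℕ) → .{{NonZero m}} → ℕ → ℕ → ℚ
P m n g = ratio (length (filter (λ x → x Data.Nat.≟ g) (allGaps m n))) (length (allGaps m n))

ConvergesTo : (ℕ → ℚ) → ℚ → Set
ConvergesTo f L = ∀ (ε : ℚ) → 0ℚ <ℚ ε → ∃[ N ] (∀ n → N ≤ n → ∣ f n - L ∣ <ℚ ε)

limitValue : (m : ℕ) → .{{NonZero m}} → ℕ → ℕ → ℚ
limitValue m zero    β = (+ β) ÷ (m * suc m)
  where instance _ = ℕP.m*n≢0 m (suc m)
limitValue m (suc α) β = (+ (suc m ∸ β)) ÷ (suc m ^ suc (suc α))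
  where instance _ = ℕP.m^n≢0 (suc m) (suc (suc α))

module Submission where

-- Let q = m + 1 and let D_k be the legal decompositions using only bins 0, …, k; these are the
-- decompositions of the integers in [0, a_{mk+1}) = [0, 2qᵏ).  A member of D_{k+1} either lies in
-- D_k or is a member of D_k followed by one of the m indices of bin k+1 (upToBin-suc).  Hence every
-- statistic that behaves additively under appending an index satisfies a linear recurrence in k:
-- |D_k| = 2qᵏ, the total number of gaps satisfies T(k+1) = q T(k) + m (2qᵏ − 1), and the number of
-- gaps of length g satisfies G(k+1) = q G(k) + H(k), where H(k) counts the gaps of length g created
-- by appending an index of bin k+1.  Locating where such a new gap starts shows that, for all large
-- k, H(k) is exactly the claimed limit Lnum/Lden times 2mqᵏ.  A comparison principle for linear
-- recurrences then bounds |Lden·G(k) − Lnum·T(k)| by O(qᵏ), while T(k) grows like k qᵏ.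

open import Defs
open import Data.Nat as ℕ using (ℕ; zero; suc; NonZero; _+_; _*_; _∸_; _^_; _≤_; _<_; _/_; _%_; z≤n; s≤s; z<s)
open import Data.Nat.Properties
open import Algebra.Properties.CommutativeSemigroup +-commutativeSemigroup
  using () renaming (interchange to +-interchange; xy∙z≈xz∙y to +-swapʳ)
open import Data.Nat.DivMod using (m≡m%n+[m/n]*n; [m+kn]%n≡m%n; m<n⇒m%n≡m; m<n*o⇒m/o<n)
open import Data.Nat.Tactic.RingSolver using (solve-∀)
open import Data.Nat.ListAction using (sum)
open import Data.Nat.ListAction.Properties using (sum-++)
open import Data.Nat.Coprimality using (Coprime)
open import Data.Integer as ℤ using (+[1+_]; -[1+_]; _⊖_)
import Data.Integer.Properties as ℤ
open import Data.Rational using (ℚ; mkℚ; ∣_∣; _-_; toℚᵘ; *<*) renaming (_/_ to _÷_; _<_ to _<ℚ_)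
import Data.Rational as ℚ
import Data.Rational.Properties as ℚ
open import Data.Rational.Unnormalised as ℚᵘ using (mkℚᵘ)
import Data.Rational.Unnormalised.Properties as ℚᵘ
open import Data.List using (List; []; _∷_; _++_; map; length; filter; _∷ʳ_; concatMap)
open import Data.List.Properties using (map-++; map-cong; filter-++; filter-accept; filter-reject; filter-none; filter-all; length-++; length-map; ++-assoc; ++-identityʳ)
open import Data.List.Relation.Unary.All as All using (All; []; _∷_)
import Data.List.Relation.Unary.All.Properties as All
open import Data.List.Relation.Unary.AllPairs using (AllPairs; allPairs?; []; _∷_)
import Data.List.Relation.Unary.AllPairs.Properties as AllPairs
open import Data.Product using (_×_; _,_; proj₁; proj₂; ∃-syntax)
open import Data.Sum using (inj₁; inj₂)
open import Data.Bool using (true; false)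
open import Data.Empty using (⊥-elim)
open import Function using (_∘_)
open import Level using (0ℓ)
open import Relation.Binary.PropositionalEquality
open import Relation.Nullary using (¬_; does; yes; no; contradiction)
open import Relation.Nullary.Decidable using (¬?; _×-dec_)
open import Relation.Unary using (Pred; Decidable)

sumTo : ℕ → (ℕ → ℕ) → ℕ
sumTo zero    f = 0
sumTo (suc n) f = sumTo n f + f n

sumTo-cong : ∀ n {f g : ℕ → ℕ} → (∀ t → t < n → f t ≡ g t) → sumTo n f ≡ sumTo n g
sumTo-cong zero    eq = refl
sumTo-cong (suc n) eq = cong₂ _+_ (sumTo-cong n (λ t t<n → eq t (m<n⇒m<1+n t<n))) (eq n (n<1+n n))

sumTo-const : ∀ n c → sumTo n (λ _ → c) ≡ n * c
sumTo-const zero    c = refl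
sumTo-const (suc n) c = trans (cong (_+ c) (sumTo-const n c)) (+-comm (n * c) c)

sumTo-+ : ∀ n (f g : ℕ → ℕ) → sumTo n (λ t → f t + g t) ≡ sumTo n f + sumTo n g
sumTo-+ zero    f g = refl
sumTo-+ (suc n) f g = trans (cong (_+ (f n + g n)) (sumTo-+ n f g))
                            (+-interchange (sumTo n f) (sumTo n g) (f n) (g n))

sumTo-++ : ∀ a b (f : ℕ → ℕ) → sumTo (a + b) f ≡ sumTo a f + sumTo b (λ t → f (a + t))
sumTo-++ a zero    f = trans (cong (λ n → sumTo n f) (+-identityʳ a)) (sym (+-identityʳ (sumTo a f)))
sumTo-++ a (suc b) f = begin
  sumTo (a + suc b) f                               ≡⟨ cong (λ n → sumTo n f) (+-suc a b) ⟩
  sumTo (a + b) f + f (a + b)                       ≡⟨ cong (_+ f (a + b)) (sumTo-++ a b f) ⟩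
  sumTo a f + sumTo b (λ t → f (a + t)) + f (a + b) ≡⟨ +-assoc (sumTo a f) _ (f (a + b)) ⟩
  sumTo a f + sumTo (suc b) (λ t → f (a + t))       ∎
  where open ≡-Reasoning

sumTo-prefix : ∀ a n (f : ℕ → ℕ) → a ≤ n → (∀ t → a ≤ t → t < n → f t ≡ 0) → sumTo n f ≡ sumTo a f
sumTo-prefix a n f a≤n vanish = begin
  sumTo n f                                     ≡⟨ cong (λ k → sumTo k f) (sym (m+[n∸m]≡n a≤n)) ⟩
  sumTo (a + (n ∸ a)) f                         ≡⟨ sumTo-++ a (n ∸ a) f ⟩
  sumTo a f + sumTo (n ∸ a) (λ t → f (a + t))   ≡⟨ cong (sumTo a f +_) (trans (sumTo-cong (n ∸ a) tail) (sumTo-const (n ∸ a) 0)) ⟩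
  sumTo a f + (n ∸ a) * 0                       ≡⟨ cong (sumTo a f +_) (*-zeroʳ (n ∸ a)) ⟩
  sumTo a f + 0                                 ≡⟨ +-identityʳ (sumTo a f) ⟩
  sumTo a f                                     ∎
  where
  open ≡-Reasoning
  tail : ∀ t → t < n ∸ a → f (a + t) ≡ 0
  tail t t<n∸a = vanish (a + t) (m≤m+n a t) (subst (a + t <_) (m+[n∸m]≡n a≤n) (+-monoʳ-< a t<n∸a))

sumTo-zero : ∀ n (f : ℕ → ℕ) → (∀ t → t < n → f t ≡ 0) → sumTo n f ≡ 0
sumTo-zero n f vanish = sumTo-prefix 0 n f z≤n (λ t _ → vanish t)

sumTo-single : ∀ n s (f : ℕ → ℕ) → s < n → (∀ t → t < n → t ≢ s → f t ≡ 0) → sumTo n f ≡ f s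
sumTo-single n s f s<n vanish = begin
  sumTo n f         ≡⟨ sumTo-prefix (suc s) n f s<n (λ t s<t t<n → vanish t t<n (≢-sym (<⇒≢ s<t))) ⟩
  sumTo s f + f s   ≡⟨ cong (_+ f s) (sumTo-zero s f (λ t t<s → vanish t (<-trans t<s s<n) (<⇒≢ t<s))) ⟩
  f s               ∎
  where open ≡-Reasoning

sumTo-step : ∀ n β A B (f : ℕ → ℕ) → β ≤ n → (∀ t → t < β → f t ≡ A) → (∀ t → β ≤ t → t < n → f t ≡ B) →
             sumTo n f ≡ β * A + (n ∸ β) * B
sumTo-step n β A B f β≤n low high = begin
  sumTo n f                                     ≡⟨ cong (λ k → sumTo k f) (sym (m+[n∸m]≡n β≤n)) ⟩
  sumTo (β + (n ∸ β)) f                         ≡⟨ sumTo-++ β (n ∸ β) f ⟩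
  sumTo β f + sumTo (n ∸ β) (λ t → f (β + t))   ≡⟨ cong₂ _+_ (sumTo-cong β low) (sumTo-cong (n ∸ β) high′) ⟩
  sumTo β (λ _ → A) + sumTo (n ∸ β) (λ _ → B)   ≡⟨ cong₂ _+_ (sumTo-const β A) (sumTo-const (n ∸ β) B) ⟩
  β * A + (n ∸ β) * B                           ∎
  where
  open ≡-Reasoning
  high′ : ∀ t → t < n ∸ β → f (β + t) ≡ B
  high′ t t<n∸β = high (β + t) (m≤m+n β t) (subst (β + t <_) (m+[n∸m]≡n β≤n) (+-monoʳ-< β t<n∸β))

filter-map : ∀ {A B : Set} {P : Pred B 0ℓ} (P? : Decidable P) (f : A → B) xs →
             filter P? (map f xs) ≡ map f (filter (P? ∘ f) xs)
filter-map P? f []       = refl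
filter-map P? f (x ∷ xs) with does (P? (f x))
... | true  = cong (f x ∷_) (filter-map P? f xs)
... | false = filter-map P? f xs

filter-cong-local : ∀ {A : Set} {P Q : Pred A 0ℓ} (P? : Decidable P) (Q? : Decidable Q) {xs} →
                    All (λ x → (P x → Q x) × (Q x → P x)) xs → filter P? xs ≡ filter Q? xs
filter-cong-local P? Q? []                   = refl
filter-cong-local P? Q? {x ∷ xs} ((p⇒q , q⇒p) ∷ rest) with P? x | Q? x
... | yes p | yes q = cong (x ∷_) (filter-cong-local P? Q? rest)
... | yes p | no ¬q = ⊥-elim (¬q (p⇒q p))
... | no ¬p | yes q = ⊥-elim (¬p (q⇒p q))
... | no ¬p | no ¬q = filter-cong-local P? Q? rest

snoc⁺ : ∀ {R : ℕ → ℕ → Set} {xs y} → AllPairs R xs → All (λ x → R x y) xs → AllPairs R (xs ∷ʳ y)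
snoc⁺ pairs rel = AllPairs.++⁺ pairs ([] ∷ []) (All.map (_∷ []) rel)

snoc⁻ : ∀ {R : ℕ → ℕ → Set} xs {y} → AllPairs R (xs ∷ʳ y) → AllPairs R xs × All (λ x → R x y) xs
snoc⁻ []       _             = [] , []
snoc⁻ (x ∷ xs) (rx ∷ pairs) with All.∷ʳ⁻ rx | snoc⁻ xs pairs
... | rxs , rxy | pairs′ , rel = (rxs ∷ pairs′) , (rxy ∷ rel)

sumOver : {A : Set} → (A → ℕ) → List A → ℕ
sumOver h X = sum (map h X)

module _ {A : Set} where

  sumOver-++ : ∀ (h : A → ℕ) X Y → sumOver h (X ++ Y) ≡ sumOver h X + sumOver h Y
  sumOver-++ h X Y = trans (cong sum (map-++ h X Y)) (sum-++ (map h X) (map h Y))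

  sumOver-map : ∀ (h : A → ℕ) (f : A → A) X → sumOver h (map f X) ≡ sumOver (h ∘ f) X
  sumOver-map h f []      = refl
  sumOver-map h f (x ∷ X) = cong (h (f x) +_) (sumOver-map h f X)

  sumOver-const : ∀ c (X : List A) → sumOver (λ _ → c) X ≡ c * length X
  sumOver-const c []      = sym (*-zeroʳ c)
  sumOver-const c (x ∷ X) = trans (cong (c +_) (sumOver-const c X)) (sym (*-suc c (length X)))

  sumOver-length : ∀ (X : List A) → sumOver (λ _ → 1) X ≡ length X
  sumOver-length X = trans (sumOver-const 1 X) (*-identityˡ (length X))

  sumOver-cong : ∀ {P : A → Set} (h h′ : A → ℕ) {X} → (∀ x → P x → h x ≡ h′ x) → All P X →
                 sumOver h X ≡ sumOver h′ X
  sumOver-cong h h′ eq []       = refl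
  sumOver-cong h h′ eq (p ∷ ps) = cong₂ _+_ (eq _ p) (sumOver-cong h h′ eq ps)

  sumOver-cong-all : ∀ (h h′ : A → ℕ) X → (∀ x → h x ≡ h′ x) → sumOver h X ≡ sumOver h′ X
  sumOver-cong-all h h′ X eq = cong sum (map-cong eq X)

  sumOver-+ : ∀ (h h′ : A → ℕ) X → sumOver (λ x → h x + h′ x) X ≡ sumOver h X + sumOver h′ X
  sumOver-+ h h′ []      = refl
  sumOver-+ h h′ (x ∷ X) = trans (cong (h x + h′ x +_) (sumOver-+ h h′ X))
                                 (+-interchange (h x) (h′ x) (sumOver h X) (sumOver h′ X))

occurrences : ℕ → List ℕ → ℕ
occurrences g xs = length (filter (λ x → x ℕ.≟ g) xs)

occurrences-++ : ∀ g xs ys → occurrences g (xs ++ ys) ≡ occurrences g xs + occurrences g ys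
occurrences-++ g xs ys = trans (cong length (filter-++ (λ x → x ℕ.≟ g) xs ys))
                               (length-++ (filter (λ x → x ℕ.≟ g) xs))

occurrences-self : ∀ i → occurrences i (i ∷ []) ≡ 1
occurrences-self i = cong length (filter-accept (λ x → x ℕ.≟ i) refl)

occurrences-other : ∀ i j → j ≢ i → occurrences i (j ∷ []) ≡ 0
occurrences-other i j j≢i = cong length (filter-reject (λ x → x ℕ.≟ i) j≢i)

occurrences-below : ∀ i xs → All (_< i) xs → occurrences i xs ≡ 0
occurrences-below i xs small = cong length (filter-none (λ x → x ℕ.≟ i) (All.map (λ x<i x≡i → <-irrefl x≡i x<i) small))

occurrences-reflect : ∀ i g j xs → i + g ≡ j → All (_≤ j) xs → occurrences g (map (j ∸_) xs) ≡ occurrences i xs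
occurrences-reflect i g j xs i+g≡j xs≤j = begin
  length (filter (λ x → x ℕ.≟ g) (map (j ∸_) xs))        ≡⟨ cong length (filter-map (λ x → x ℕ.≟ g) (j ∸_) xs) ⟩
  length (map (j ∸_) (filter (λ x → j ∸ x ℕ.≟ g) xs))    ≡⟨ length-map (j ∸_) (filter (λ x → j ∸ x ℕ.≟ g) xs) ⟩
  length (filter (λ x → j ∸ x ℕ.≟ g) xs)                 ≡⟨ cong length (filter-cong-local _ _ (All.map (λ x≤j → to x≤j , from x≤j) xs≤j)) ⟩
  length (filter (λ x → x ℕ.≟ i) xs) ∎
  where
  open ≡-Reasoning
  j∸g≡i : j ∸ g ≡ i
  j∸g≡i = trans (cong (_∸ g) (sym i+g≡j)) (m+n∸n≡m i g)
  to : ∀ {x} → x ≤ j → j ∸ x ≡ g → x ≡ i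
  to {x} x≤j eq = trans (sym (m∸[m∸n]≡n x≤j)) (trans (cong (j ∸_) eq) j∸g≡i)
  from : ∀ {x} → x ≤ j → x ≡ i → j ∸ x ≡ g
  from x≤j refl = trans (cong (j ∸_) (sym j∸g≡i)) (m∸[m∸n]≡n (subst (g ≤_) i+g≡j (m≤n+m g i)))

lastOf : List ℕ → List ℕ
lastOf []          = []
lastOf (x ∷ [])    = x ∷ []
lastOf (x ∷ y ∷ r) = lastOf (y ∷ r)

lastOf-snoc : ∀ ls j → lastOf (ls ∷ʳ j) ≡ j ∷ []
lastOf-snoc []          j = refl
lastOf-snoc (x ∷ [])    j = refl
lastOf-snoc (x ∷ y ∷ r) j = lastOf-snoc (y ∷ r) j

lastOf-All : ∀ {P : ℕ → Set} ls → All P ls → All P (lastOf ls)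
lastOf-All []          ps       = []
lastOf-All (x ∷ [])    ps       = ps
lastOf-All (x ∷ y ∷ r) (_ ∷ ps) = lastOf-All (y ∷ r) ps

gaps-snoc : ∀ ls j → gaps (ls ∷ʳ j) ≡ gaps ls ++ map (j ∸_) (lastOf ls)
gaps-snoc []          j = refl
gaps-snoc (x ∷ [])    j = refl
gaps-snoc (x ∷ y ∷ r) j = cong ((y ∸ x) ∷_) (gaps-snoc (y ∷ r) j)

-- a/b and c/d are within E/F of each other, certified in ℕ: the cross products a·d and c·b
-- differ by at most some D with  D·F < E·b·d.
CloseWithin : (a b c d E F : ℕ) → Set
CloseWithin a b c d E F = ∃[ D ] (a * d ≤ c * b + D) × (c * b ≤ a * d + D) × (D * F < E * (b * d))

close-fractionsᵘ : ∀ a b c d e f → CloseWithin a (suc b) c (suc d) (suc e) (suc f) →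
  ℚᵘ.∣ mkℚᵘ (ℤ.+ a) b ℚᵘ.- mkℚᵘ (ℤ.+ c) d ∣ ℚᵘ.< mkℚᵘ (ℤ.+ suc e) f
close-fractionsᵘ a b c d e f (D , ad≤cb+D , cb≤ad+D , DF<Ebd) = ℚᵘ.*<* goal
  where
  X Y F bd : ℕ
  X = a * suc d
  Y = c * suc b
  F = suc f
  bd = suc b * suc d
  numerator : ℤ.+ a ℤ.* ℤ.+ suc d ℤ.+ (ℤ.- (ℤ.+ c)) ℤ.* ℤ.+ suc b ≡ X ⊖ Y
  numerator = trans (cong₂ ℤ._+_ (sym (ℤ.pos-* a (suc d)))
                                (trans (sym (ℤ.neg-distribˡ-* (ℤ.+ c) (ℤ.+ suc b))) (cong ℤ.-_ (sym (ℤ.pos-* c (suc b))))))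
                    (ℤ.m-n≡m⊖n X Y)
  -- |X − Y| ≤ D, hence |X − Y|·F ≤ D·F < E·b·d.
  distance : ℤ.∣ X ⊖ Y ∣ ≤ D
  distance with ≤-total X Y
  ... | inj₁ X≤Y rewrite ℤ.∣⊖∣-≤ X≤Y = m≤n+o⇒m∸n≤o Y X cb≤ad+D
  ... | inj₂ Y≤X rewrite ℤ.∣m⊖n∣≡∣n⊖m∣ X Y | ℤ.∣⊖∣-≤ Y≤X = m≤n+o⇒m∸n≤o X Y ad≤cb+D
  goal : ℤ.+ ℤ.∣ ℤ.+ a ℤ.* ℤ.+ suc d ℤ.+ (ℤ.- (ℤ.+ c)) ℤ.* ℤ.+ suc b ∣ ℤ.* ℤ.+ F ℤ.< ℤ.+ suc e ℤ.* ℤ.+ bd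
  goal rewrite numerator = subst₂ ℤ._<_ (ℤ.pos-* (ℤ.∣ X ⊖ Y ∣) F) (ℤ.pos-* (suc e) bd)
                                  (ℤ.+<+ (≤-<-trans (*-monoˡ-≤ F distance) DF<Ebd))

close-fractions : ∀ a b c d .{{_ : NonZero b}} .{{_ : NonZero d}} e f .(cop : Coprime (suc e) (suc f)) →
  CloseWithin a b c d (suc e) (suc f) → ∣ (ℤ.+ a ÷ b) - (ℤ.+ c ÷ d) ∣ <ℚ mkℚ (ℤ.+ suc e) f cop
close-fractions a (suc b) c (suc d) e f cop close =
  ℚ.toℚᵘ-cancel-< (ℚᵘ.<-respˡ-≃ (ℚᵘ.≃-sym toℚᵘ-distance) (close-fractionsᵘ a b c d e f close))
  where
  x y : ℚ
  x = ℤ.+ a ÷ suc b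
  y = ℤ.+ c ÷ suc d
  toℚᵘ-÷ : ∀ n k → toℚᵘ (ℤ.+ n ÷ suc k) ℚᵘ.≃ mkℚᵘ (ℤ.+ n) k
  toℚᵘ-÷ n k = ℚ.toℚᵘ-fromℚᵘ (mkℚᵘ (ℤ.+ n) k)
  toℚᵘ-distance : toℚᵘ ∣ x - y ∣ ℚᵘ.≃ ℚᵘ.∣ mkℚᵘ (ℤ.+ a) b ℚᵘ.- mkℚᵘ (ℤ.+ c) d ∣
  toℚᵘ-distance = ℚᵘ.≃-trans (ℚ.toℚᵘ-homo-∣-∣ (x - y))
    (ℚᵘ.∣-∣-cong (ℚᵘ.≃-trans (ℚ.toℚᵘ-homo-+ x (ℚ.- y))
      (ℚᵘ.+-cong (toℚᵘ-÷ a b) (ℚᵘ.≃-trans (ℚ.toℚᵘ-homo‿- y) (ℚᵘ.-‿cong (toℚᵘ-÷ c d))))))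

CloseWithin-positive : ∀ a b c d E F → CloseWithin a b c d E F → 0 < b
CloseWithin-positive a zero    c d E F (D , _ , _ , DF<0) = contradiction (subst (D * F <_) (*-zeroʳ E) DF<0) n≮0
CloseWithin-positive a (suc b) c d E F _                  = z<s

ratio-converges : ∀ (G T : ℕ → ℕ) Lnum Lden .{{_ : NonZero Lden}} →
  (∀ e f → ∃[ N ] (∀ n → N ≤ n → CloseWithin (G n) (T n) Lnum Lden (suc e) (suc f))) →
  ConvergesTo (λ n → ratio (G n) (T n)) (ℤ.+ Lnum ÷ Lden)
ratio-converges G T Lnum Lden eventually (mkℚ +[1+ e ] f cop) _ with eventually e f
... | N , close = N , λ n N≤n → within (G n) (T n) (close n N≤n)
  where
  within : ∀ a b → CloseWithin a b Lnum Lden (suc e) (suc f) → ∣ ratio a b - ℤ.+ Lnum ÷ Lden ∣ <ℚ mkℚ +[1+ e ] f cop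
  within a zero    c = contradiction (CloseWithin-positive a 0 Lnum Lden (suc e) (suc f) c) n≮0
  within a (suc b) c = close-fractions a (suc b) Lnum Lden e f cop c
ratio-converges G T Lnum Lden eventually (mkℚ (ℤ.+ zero) f cop) (*<* (ℤ.+<+ ()))
ratio-converges G T Lnum Lden eventually (mkℚ -[1+ e ] f cop) (*<* ())

dominated : ∀ q s (A B Z : ℕ → ℕ) →
  (∀ k → A (suc k) + s ≤ q * A k + Z k) → (∀ k → q * B k + Z k ≤ B (suc k) + s) →
  ∀ k → A k ≤ B k + A 0 * q ^ k
dominated q s A B Z A-rec B-rec zero =
  subst (A 0 ≤_) (cong (B 0 +_) (sym (*-identityʳ (A 0)))) (m≤n+m (A 0) (B 0))
dominated q s A B Z A-rec B-rec (suc k) = +-cancelʳ-≤ s _ _ (begin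
  A (suc k) + s                            ≤⟨ A-rec k ⟩
  q * A k + Z k                            ≤⟨ +-monoˡ-≤ (Z k) (*-monoʳ-≤ q (dominated q s A B Z A-rec B-rec k)) ⟩
  q * (B k + A 0 * q ^ k) + Z k            ≡⟨ regroup q (B k) (A 0) (q ^ k) (Z k) ⟩
  (q * B k + Z k) + A 0 * (q * q ^ k)      ≤⟨ +-monoˡ-≤ _ (B-rec k) ⟩
  B (suc k) + s + A 0 * q ^ suc k          ≡⟨ +-swapʳ (B (suc k)) s (A 0 * q ^ suc k) ⟩
  B (suc k) + A 0 * q ^ suc k + s          ∎)
  where
  open ≤-Reasoning
  regroup : ∀ q b a x z → q * (b + a * x) + z ≡ q * b + z + a * (q * x)
  regroup = solve-∀

module Growth (m : ℕ) .{{_ : NonZero m}} (T Ne : ℕ → ℕ)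
  (T-suc : ∀ k → T (suc k) ≡ suc m * T k + m * Ne k)
  (Ne-eq : ∀ k → Ne k + 1 ≡ 2 * suc m ^ k) where

  q : ℕ
  q = suc m

  Ne-lower : ∀ k → q ^ k ≤ Ne k
  Ne-lower k = +-cancelʳ-≤ 1 (q ^ k) (Ne k) (begin
    q ^ k + 1       ≤⟨ +-monoʳ-≤ (q ^ k) (m^n>0 q k) ⟩
    q ^ k + q ^ k   ≡⟨ double (q ^ k) ⟩
    2 * q ^ k       ≡⟨ Ne-eq k ⟨
    Ne k + 1        ∎)
    where
    open ≤-Reasoning
    double : ∀ x → x + x ≡ 2 * x
    double = solve-∀

  -- T grows like k qᵏ, faster than any constant multiple of qᵏ.
  T-lower : ∀ k → k * m * q ^ k ≤ q * T k
  T-lower zero    = z≤n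
  T-lower (suc k) = begin
    suc k * m * q ^ suc k                   ≡⟨ expand k m (q ^ k) ⟩
    q * (k * m * q ^ k) + q * (m * q ^ k)   ≤⟨ +-mono-≤ (*-monoʳ-≤ q (T-lower k)) (*-monoʳ-≤ q (*-monoʳ-≤ m (Ne-lower k))) ⟩
    q * (q * T k) + q * (m * Ne k)          ≡⟨ *-distribˡ-+ q (q * T k) (m * Ne k) ⟨
    q * (q * T k + m * Ne k)                ≡⟨ cong (q *_) (T-suc k) ⟨
    q * T (suc k)                           ∎
    where
    open ≤-Reasoning
    expand : ∀ k m x → suc k * m * (suc m * x) ≡ suc m * (k * m * x) + suc m * (m * x)
    expand = solve-∀

-- If moreover  G(k+1) = q G(k) + H(k)  where, from K0 on, the new contributions H(k) are exactly
-- Lnum/Lden times the  2 m qᵏ  new nonempty-list contributions to T, then  G/T → Lnum/Lden.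
module Limit (m : ℕ) .{{_ : NonZero m}} (T Ne : ℕ → ℕ)
  (T-suc : ∀ k → T (suc k) ≡ suc m * T k + m * Ne k)
  (Ne-eq : ∀ k → Ne k + 1 ≡ 2 * suc m ^ k)
  (G H : ℕ → ℕ) (G-suc : ∀ k → G (suc k) ≡ suc m * G k + H k)
  (Lnum Lden K0 : ℕ) .{{_ : NonZero Lden}}
  (H-eq : ∀ k → K0 ≤ k → H k * Lden ≡ 2 * m * Lnum * suc m ^ k) where

  open Growth m T Ne T-suc Ne-eq

  -- The two cross products compared in the certificate, and their common forcing term.
  X Y Z : ℕ → ℕ
  X k = G k * Lden
  Y k = Lnum * T k
  Z k = 2 * m * Lnum * q ^ k

  c : ℕ
  c = m * Lnum

  X-suc : ∀ k → K0 ≤ k → X (suc k) ≡ q * X k + Z k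
  X-suc k K0≤k = begin
    G (suc k) * Lden             ≡⟨ cong (_* Lden) (G-suc k) ⟩
    (q * G k + H k) * Lden       ≡⟨ *-distribʳ-+ Lden (q * G k) (H k) ⟩
    q * G k * Lden + H k * Lden  ≡⟨ cong₂ _+_ (*-assoc q (G k) Lden) (H-eq k K0≤k) ⟩
    q * X k + Z k                ∎
    where open ≡-Reasoning

  Y-suc : ∀ k → Y (suc k) + c ≡ q * Y k + Z k
  Y-suc k = begin
    Lnum * T (suc k) + m * Lnum                 ≡⟨ cong (λ t → Lnum * t + m * Lnum) (T-suc k) ⟩
    Lnum * (q * T k + m * Ne k) + m * Lnum      ≡⟨ collect m Lnum (T k) (Ne k) ⟩
    q * Y k + m * Lnum * (Ne k + 1)             ≡⟨ cong (λ n → q * Y k + m * Lnum * n) (Ne-eq k) ⟩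
    q * Y k + m * Lnum * (2 * q ^ k)            ≡⟨ cong (q * Y k +_) (reassociate m Lnum (q ^ k)) ⟩
    q * Y k + Z k                               ∎
    where
    open ≡-Reasoning
    collect : ∀ m L t n → L * (suc m * t + m * n) + m * L ≡ suc m * (L * t) + m * L * (n + 1)
    collect = solve-∀
    reassociate : ∀ m L x → m * L * (2 * x) ≡ 2 * m * L * x
    reassociate = solve-∀

  Xs Ys Zs : ℕ → ℕ
  Xs k = X (K0 + k)
  Ys k = Y (K0 + k)
  Zs k = Z (K0 + k)

  Xs-suc : ∀ k → Xs (suc k) ≡ q * Xs k + Zs k
  Xs-suc k = trans (cong X (+-suc K0 k)) (X-suc (K0 + k) (m≤m+n K0 k))

  Ys-suc : ∀ k → Ys (suc k) + c ≡ q * Ys k + Zs k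
  Ys-suc k = trans (cong (λ n → Y n + c) (+-suc K0 k)) (Y-suc (K0 + k))

  C : ℕ
  C = Xs 0 + Ys 0 + c

  -- Since q ≥ 2, the constant c can be absorbed twice.
  c+c≤q*c : c + c ≤ q * c
  c+c≤q*c = +-monoʳ-≤ c (m≤n*m c m)

  X-upper : ∀ k → Xs k ≤ Ys k + C * q ^ k
  X-upper k = ≤-trans (m≤m+n (Xs k) c) (≤-trans (dominated q c (λ k → Xs k + c) Ys Zs A-rec B-rec k)
                        (+-monoʳ-≤ (Ys k) (*-monoˡ-≤ (q ^ k) (+-monoˡ-≤ c (m≤m+n (Xs 0) (Ys 0))))))
    where
    A-rec : ∀ k → Xs (suc k) + c + c ≤ q * (Xs k + c) + Zs k
    A-rec k = begin
      Xs (suc k) + c + c          ≡⟨ cong (λ x → x + c + c) (Xs-suc k) ⟩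
      q * Xs k + Zs k + c + c     ≡⟨ shuffle (q * Xs k) (Zs k) c ⟩
      q * Xs k + (c + c) + Zs k   ≤⟨ +-monoˡ-≤ (Zs k) (+-monoʳ-≤ (q * Xs k) c+c≤q*c) ⟩
      q * Xs k + q * c + Zs k     ≡⟨ cong (_+ Zs k) (*-distribˡ-+ q (Xs k) c) ⟨
      q * (Xs k + c) + Zs k       ∎
      where
      open ≤-Reasoning
      shuffle : ∀ a z c → a + z + c + c ≡ a + (c + c) + z
      shuffle = solve-∀
    B-rec : ∀ k → q * Ys k + Zs k ≤ Ys (suc k) + c
    B-rec k = ≤-reflexive (sym (Ys-suc k))

  Y-upper : ∀ k → Ys k ≤ Xs k + C * q ^ k
  Y-upper k = ≤-trans (m≤m+n (Ys k) c) (≤-trans (dominated q 0 (λ k → Ys k + c) Xs Zs A-rec B-rec k)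
                        (+-monoʳ-≤ (Xs k) (*-monoˡ-≤ (q ^ k) (+-monoˡ-≤ c (m≤n+m (Ys 0) (Xs 0))))))
    where
    A-rec : ∀ k → Ys (suc k) + c + 0 ≤ q * (Ys k + c) + Zs k
    A-rec k = begin
      Ys (suc k) + c + 0          ≡⟨ +-identityʳ _ ⟩
      Ys (suc k) + c              ≡⟨ Ys-suc k ⟩
      q * Ys k + Zs k             ≤⟨ +-monoˡ-≤ (Zs k) (*-monoʳ-≤ q (m≤m+n (Ys k) c)) ⟩
      q * (Ys k + c) + Zs k       ∎
      where open ≤-Reasoning
    B-rec : ∀ k → q * Xs k + Zs k ≤ Xs (suc k) + 0
    B-rec k = ≤-reflexive (trans (sym (Xs-suc k)) (sym (+-identityʳ _)))

  -- From  K0 + 1 + C F q  on, the discrepancy  C q^(n−K0)  is below  E/F  times  T n Lden,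
  -- because T n grows like n qⁿ.
  eventually-close : ∀ e f → ∃[ N ] (∀ n → N ≤ n → CloseWithin (G n) (T n) Lnum Lden (suc e) (suc f))
  eventually-close e f = K0 + suc (C * F * q) , close
    where
    E F : ℕ
    E = suc e
    F = suc f
    close : ∀ n → K0 + suc (C * F * q) ≤ n → CloseWithin (G n) (T n) Lnum Lden E F
    close n N≤n = C * q ^ k′ , upper , lower , small
      where
      k′ : ℕ
      k′ = n ∸ K0
      n≡K0+k′ : K0 + k′ ≡ n
      n≡K0+k′ = m+[n∸m]≡n (≤-trans (m≤m+n K0 _) N≤n)
      CFq<k′ : C * F * q < k′
      CFq<k′ = +-cancelˡ-≤ K0 _ _ (subst (K0 + suc (C * F * q) ≤_) (sym n≡K0+k′) N≤n)
      k′≤n : k′ ≤ n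
      k′≤n = m∸n≤m n K0
      upper : G n * Lden ≤ Lnum * T n + C * q ^ k′
      upper = subst (λ n → X n ≤ Y n + C * q ^ k′) n≡K0+k′ (X-upper k′)
      lower : Lnum * T n ≤ G n * Lden + C * q ^ k′
      lower = subst (λ n → Y n ≤ X n + C * q ^ k′) n≡K0+k′ (Y-upper k′)
      instance
        q^k′≢0 : NonZero (q ^ k′)
        q^k′≢0 = m^n≢0 q k′
      small : C * q ^ k′ * F < E * (T n * Lden)
      small = *-cancelˡ-< q _ _ (begin-strict
        q * (C * q ^ k′ * F)     ≡⟨ reorder q C (q ^ k′) F ⟩
        C * F * q * q ^ k′       <⟨ *-monoˡ-< (q ^ k′) CFq<k′ ⟩
        k′ * q ^ k′              ≤⟨ *-mono-≤ k′≤n (^-monoʳ-≤ q k′≤n) ⟩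
        n * q ^ n                ≤⟨ *-monoˡ-≤ (q ^ n) (m≤m*n n m) ⟩
        n * m * q ^ n            ≤⟨ T-lower n ⟩
        q * T n                  ≤⟨ *-monoʳ-≤ q (≤-trans (m≤m*n (T n) Lden) (m≤n*m (T n * Lden) E)) ⟩
        q * (E * (T n * Lden))   ∎)
        where
        open ≤-Reasoning
        reorder : ∀ q c x f → q * (c * x * f) ≡ c * f * q * x
        reorder = solve-∀

  converges : ConvergesTo (λ n → ratio (G n) (T n)) (ℤ.+ Lnum ÷ Lden)
  converges = ratio-converges G T Lnum Lden eventually-close

incLists-bounded : ∀ N → All (All (_< N)) (incLists N)
incLists-bounded zero    = [] ∷ []
incLists-bounded (suc N) =
  All.++⁺ (All.map (All.map m<n⇒m<1+n) (incLists-bounded N))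
          (All.map⁺ (All.map (λ below → All.∷ʳ⁺ (All.map m<n⇒m<1+n below) (n<1+n N)) (incLists-bounded N)))

module Bins (m : ℕ) .{{_ : NonZero m}} where

  q : ℕ
  q = suc m

  -- The t-th index (t < m) of bin k+1:  a (idx k t) = 2 (t+1) (m+1)^k.
  idx : ℕ → ℕ → ℕ
  idx k t = suc (m * k + t)

  idx-mod : ∀ k t → t < m → (m * k + t) % m ≡ t
  idx-mod k t t<m = begin
    (m * k + t) % m ≡⟨ cong (_% m) (trans (+-comm (m * k) t) (cong (t +_) (*-comm m k))) ⟩
    (t + k * m) % m ≡⟨ [m+kn]%n≡m%n t k m ⟩
    t % m           ≡⟨ m<n⇒m%n≡m t<m ⟩
    t               ∎
    where open ≡-Reasoning

  idx-div : ∀ k t → t < m → (m * k + t) / m ≡ k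
  idx-div k t t<m = sym (*-cancelʳ-≡ k ((m * k + t) / m) m (+-cancelˡ-≡ t _ _ divmod))
    where
    divmod : t + k * m ≡ t + (m * k + t) / m * m
    divmod = trans (trans (cong (t +_) (*-comm k m)) (+-comm t (m * k)))
                   (trans (m≡m%n+[m/n]*n (m * k + t) m) (cong (_+ (m * k + t) / m * m) (idx-mod k t t<m)))

  bin-idx : ∀ k t → t < m → bin m (idx k t) ≡ suc k
  bin-idx k t t<m = cong suc (idx-div k t t<m)

  a-idx : ∀ k t → t < m → a m (idx k t) ≡ 2 * (t + 1) * q ^ k
  a-idx k t t<m = cong₂ (λ r e → 2 * (r + 1) * q ^ e) (idx-mod k t t<m) (idx-div k t t<m)

  bin-below : ∀ k x → x < suc (m * k) → bin m x ≢ suc k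
  bin-below k zero    _           ()
  bin-below k (suc x) (s≤s x<mk) eq =
    <-irrefl (suc-injective eq) (m<n*o⇒m/o<n (subst (x <_) (*-comm m k) x<mk))

  legal? : Decidable (Legal m)
  legal? = allPairs? (λ i j → ¬? (bin m i ℕ.≟ bin m j))

  legalWithin : ℕ → List (List ℕ)
  legalWithin N = filter legal? (incLists N)

  -- Legal decompositions using only the bins 0, …, k, i.e. indices ≤ mk.
  upToBin : ℕ → List (List ℕ)
  upToBin k = legalWithin (suc (m * k))

  upToBin-zero : upToBin 0 ≡ [] ∷ (0 ∷ []) ∷ []
  upToBin-zero rewrite *-zeroʳ m = refl

  upToBin-bounded : ∀ k → All (All (_< suc (m * k))) (upToBin k)
  upToBin-bounded k = All.filter⁺ legal? (incLists-bounded (suc (m * k)))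

  AvoidsBin : ℕ → List ℕ → Set
  AvoidsBin k ls = Legal m ls × All (λ x → bin m x ≢ suc k) ls

  avoidsBin? : ∀ k → Decidable (AvoidsBin k)
  avoidsBin? k ls = legal? ls ×-dec All.all? (λ x → ¬? (bin m x ℕ.≟ suc k)) ls

  legal-snoc : ∀ k t → t < m → ∀ ls → Legal m (ls ∷ʳ idx k t) → AvoidsBin k ls
  legal-snoc k t t<m ls legal with snoc⁻ ls legal
  ... | legal′ , apart = legal′ , All.map (λ {x} ne → subst (λ b → bin m x ≢ b) (bin-idx k t t<m) ne) apart

  snoc-legal : ∀ k t → t < m → ∀ ls → AvoidsBin k ls → Legal m (ls ∷ʳ idx k t)
  snoc-legal k t t<m ls (legal , apart) =
    snoc⁺ legal (All.map (λ {x} ne → subst (λ b → bin m x ≢ b) (sym (bin-idx k t t<m)) ne) apart)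

  avoiding-upToBin : ∀ k s → s ≤ m → filter (avoidsBin? k) (incLists (suc (m * k + s))) ≡ upToBin k
  avoiding-upToBin k zero _ rewrite +-identityʳ (m * k) =
    filter-cong-local (avoidsBin? k) legal?
      (All.map (λ below → proj₁ , λ legal → legal , All.map (bin-below k _) below) (incLists-bounded (suc (m * k))))
  avoiding-upToBin k (suc s) s<m rewrite +-suc (m * k) s = begin
    filter (avoidsBin? k) (incLists N ++ map (_∷ʳ N) (incLists N))
      ≡⟨ filter-++ (avoidsBin? k) (incLists N) _ ⟩
    filter (avoidsBin? k) (incLists N) ++ filter (avoidsBin? k) (map (_∷ʳ N) (incLists N))
      ≡⟨ cong (filter (avoidsBin? k) (incLists N) ++_) (trans (filter-map (avoidsBin? k) (_∷ʳ N) (incLists N))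
                             (cong (map (_∷ʳ N)) (filter-none (avoidsBin? k ∘ (_∷ʳ N)) (All.universal usesBin (incLists N))))) ⟩
    filter (avoidsBin? k) (incLists N) ++ []
      ≡⟨ ++-identityʳ _ ⟩
    filter (avoidsBin? k) (incLists N)
      ≡⟨ avoiding-upToBin k s (<⇒≤ s<m) ⟩
    upToBin k ∎
    where
    open ≡-Reasoning
    N : ℕ
    N = idx k s
    usesBin : ∀ ls → ¬ AvoidsBin k (ls ∷ʳ N)
    usesBin ls (_ , apart) = proj₂ (All.∷ʳ⁻ apart) (bin-idx k s s<m)

  extendedBy : ℕ → ℕ → List (List ℕ)
  extendedBy k t = map (_∷ʳ idx k t) (upToBin k)

  legalWithin-snoc : ∀ k s → s < m → legalWithin (suc (idx k s)) ≡ legalWithin (idx k s) ++ extendedBy k s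
  legalWithin-snoc k s s<m = begin
    filter legal? (incLists N ++ map (_∷ʳ N) (incLists N))
      ≡⟨ filter-++ legal? (incLists N) _ ⟩
    legalWithin N ++ filter legal? (map (_∷ʳ N) (incLists N))
      ≡⟨ cong (legalWithin N ++_) (filter-map legal? (_∷ʳ N) (incLists N)) ⟩
    legalWithin N ++ map (_∷ʳ N) (filter (legal? ∘ (_∷ʳ N)) (incLists N))
      ≡⟨ cong (λ X → legalWithin N ++ map (_∷ʳ N) X) (filter-cong-local (legal? ∘ (_∷ʳ N)) (avoidsBin? k)
                   (All.universal (λ ls → legal-snoc k s s<m ls , snoc-legal k s s<m ls) (incLists N))) ⟩
    legalWithin N ++ map (_∷ʳ N) (filter (avoidsBin? k) (incLists N))
      ≡⟨ cong (λ X → legalWithin N ++ map (_∷ʳ N) X) (avoiding-upToBin k s (<⇒≤ s<m)) ⟩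
    legalWithin N ++ extendedBy k s ∎
    where
    open ≡-Reasoning
    N : ℕ
    N = idx k s

  extensions : ℕ → ℕ → List (List ℕ)
  extensions k zero    = []
  extensions k (suc t) = extensions k t ++ extendedBy k t

  legalWithin-bin : ∀ k s → s ≤ m → legalWithin (suc (m * k + s)) ≡ upToBin k ++ extensions k s
  legalWithin-bin k zero    _   rewrite +-identityʳ (m * k) = sym (++-identityʳ (upToBin k))
  legalWithin-bin k (suc s) s<m rewrite +-suc (m * k) s = begin
    legalWithin (suc (idx k s))                              ≡⟨ legalWithin-snoc k s s<m ⟩
    legalWithin (idx k s) ++ extendedBy k s                  ≡⟨ cong (_++ extendedBy k s) (legalWithin-bin k s (<⇒≤ s<m)) ⟩
    (upToBin k ++ extensions k s) ++ extendedBy k s          ≡⟨ ++-assoc (upToBin k) (extensions k s) (extendedBy k s) ⟩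
    upToBin k ++ extensions k (suc s)                        ∎
    where open ≡-Reasoning

  upToBin-suc : ∀ k → upToBin (suc k) ≡ upToBin k ++ extensions k m
  upToBin-suc k = trans (cong (λ N → legalWithin (suc N)) (trans (*-suc m k) (+-comm m (m * k))))
                        (legalWithin-bin k m ≤-refl)

  sumOver-upToBin-suc : ∀ (h : List ℕ → ℕ) k →
    sumOver h (upToBin (suc k)) ≡ sumOver h (upToBin k) + sumTo m (λ t → sumOver (h ∘ (_∷ʳ idx k t)) (upToBin k))
  sumOver-upToBin-suc h k = trans (cong (sumOver h) (upToBin-suc k))
                                  (trans (sumOver-++ h (upToBin k) _) (cong (sumOver h (upToBin k) +_) (extensions-sum m)))
    where
    extensions-sum : ∀ s → sumOver h (extensions k s) ≡ sumTo s (λ t → sumOver (h ∘ (_∷ʳ idx k t)) (upToBin k))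
    extensions-sum zero    = refl
    extensions-sum (suc s) = trans (sumOver-++ h (extensions k s) (extendedBy k s))
                                   (cong₂ _+_ (extensions-sum s) (sumOver-map h (_∷ʳ idx k s) (upToBin k)))

  All-upToBin-suc : ∀ {P : List ℕ → Set} k → All P (upToBin k) →
    (∀ t → t < m → All (P ∘ (_∷ʳ idx k t)) (upToBin k)) → All P (upToBin (suc k))
  All-upToBin-suc {P} k base step = subst (All P) (sym (upToBin-suc k)) (All.++⁺ base (extensions-All m ≤-refl))
    where
    extensions-All : ∀ s → s ≤ m → All P (extensions k s)
    extensions-All zero    _   = []
    extensions-All (suc s) s<m = All.++⁺ (extensions-All s (<⇒≤ s<m)) (All.map⁺ (step s s<m))

gapCount : List ℕ → ℕ
gapCount ls = length (gaps ls)

isNonEmpty : List ℕ → ℕ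
isNonEmpty ls = length (lastOf ls)

gapCount-snoc : ∀ ls j → gapCount (ls ∷ʳ j) ≡ gapCount ls + isNonEmpty ls
gapCount-snoc ls j = trans (cong length (gaps-snoc ls j))
                           (trans (length-++ (gaps ls)) (cong (gapCount ls +_) (length-map (j ∸_) (lastOf ls))))

isNonEmpty-snoc : ∀ ls j → isNonEmpty (ls ∷ʳ j) ≡ 1
isNonEmpty-snoc ls j = cong length (lastOf-snoc ls j)

occurrences-gaps-snoc : ∀ g ls j →
  occurrences g (gaps (ls ∷ʳ j)) ≡ occurrences g (gaps ls) + occurrences g (map (j ∸_) (lastOf ls))
occurrences-gaps-snoc g ls j = trans (cong (occurrences g) (gaps-snoc ls j)) (occurrences-++ g (gaps ls) _)

module GapStatistics (m : ℕ) .{{m≢0 : NonZero m}} where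

  open Bins m {{m≢0}}

  count : ℕ → ℕ
  count k = length (upToBin k)

  nonEmptyCount : ℕ → ℕ
  nonEmptyCount k = sumOver isNonEmpty (upToBin k)

  totalGaps : ℕ → ℕ
  totalGaps k = sumOver gapCount (upToBin k)

  gapsOfLength : ℕ → ℕ → ℕ
  gapsOfLength g k = sumOver (occurrences g ∘ gaps) (upToBin k)

  endingAt : ℕ → ℕ → ℕ
  endingAt i k = sumOver (occurrences i ∘ lastOf) (upToBin k)

  newGaps : ℕ → ℕ → ℕ → ℕ
  newGaps g k t = sumOver (λ ls → occurrences g (map (idx k t ∸_) (lastOf ls))) (upToBin k)

  sumOver-recursion : ∀ (h : List ℕ → ℕ) (h′ : ℕ → List ℕ → ℕ) k → (∀ t ls → h (ls ∷ʳ idx k t) ≡ h′ t ls) →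
    sumOver h (upToBin (suc k)) ≡ sumOver h (upToBin k) + sumTo m (λ t → sumOver (h′ t) (upToBin k))
  sumOver-recursion h h′ k ext = trans (sumOver-upToBin-suc h k)
    (cong (sumOver h (upToBin k) +_) (sumTo-cong m (λ t _ → sumOver-cong-all _ (h′ t) (upToBin k) (ext t))))

  count-suc : ∀ k → count (suc k) ≡ count k + m * count k
  count-suc k = begin
    count (suc k)                                      ≡⟨ sumOver-length (upToBin (suc k)) ⟨
    sumOver (λ _ → 1) (upToBin (suc k))                ≡⟨ sumOver-recursion (λ _ → 1) (λ _ _ → 1) k (λ _ _ → refl) ⟩
    sumOver (λ _ → 1) (upToBin k) + sumTo m (λ _ → sumOver (λ _ → 1) (upToBin k))
                                                       ≡⟨ cong₂ (λ a b → a + sumTo m (λ _ → b)) (sumOver-length (upToBin k)) (sumOver-length (upToBin k)) ⟩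
    count k + sumTo m (λ _ → count k)                  ≡⟨ cong (count k +_) (sumTo-const m (count k)) ⟩
    count k + m * count k                              ∎
    where open ≡-Reasoning

  count-eq : ∀ k → count k ≡ 2 * q ^ k
  count-eq zero    rewrite upToBin-zero = refl
  count-eq (suc k) = trans (count-suc k) (trans (cong (λ c → c + m * c) (count-eq k)) (grow m (q ^ k)))
    where
    grow : ∀ m x → 2 * x + m * (2 * x) ≡ 2 * (suc m * x)
    grow = solve-∀

  nonEmptyCount-eq : ∀ k → nonEmptyCount k + 1 ≡ count k
  nonEmptyCount-eq zero    rewrite upToBin-zero = refl
  nonEmptyCount-eq (suc k) = begin
    nonEmptyCount (suc k) + 1                                ≡⟨ cong (_+ 1) (sumOver-recursion isNonEmpty (λ _ _ → 1) k
                                                                   (λ t ls → isNonEmpty-snoc ls (idx k t))) ⟩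
    nonEmptyCount k + sumTo m (λ _ → sumOver (λ _ → 1) (upToBin k)) + 1
                                                             ≡⟨ cong (λ c → nonEmptyCount k + sumTo m (λ _ → c) + 1) (sumOver-length (upToBin k)) ⟩
    nonEmptyCount k + sumTo m (λ _ → count k) + 1            ≡⟨ cong (λ s → nonEmptyCount k + s + 1) (sumTo-const m (count k)) ⟩
    nonEmptyCount k + m * count k + 1                        ≡⟨ +-swapʳ (nonEmptyCount k) (m * count k) 1 ⟩
    nonEmptyCount k + 1 + m * count k                        ≡⟨ cong (_+ m * count k) (nonEmptyCount-eq k) ⟩
    count k + m * count k                                    ≡⟨ count-suc k ⟨
    count (suc k)                                            ∎
    where
    open ≡-Reasoning

  -- Each of the m extensions keeps the old gaps and adds one for each nonempty decomposition.
  totalGaps-suc : ∀ k → totalGaps (suc k) ≡ q * totalGaps k + m * nonEmptyCount k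
  totalGaps-suc k = begin
    totalGaps (suc k)                                             ≡⟨ sumOver-recursion gapCount (λ _ ls → gapCount ls + isNonEmpty ls) k
                                                                       (λ t ls → gapCount-snoc ls (idx k t)) ⟩
    totalGaps k + sumTo m (λ _ → sumOver (λ ls → gapCount ls + isNonEmpty ls) (upToBin k))
                                                                  ≡⟨ cong (λ s → totalGaps k + sumTo m (λ _ → s)) (sumOver-+ gapCount isNonEmpty (upToBin k)) ⟩
    totalGaps k + sumTo m (λ _ → totalGaps k + nonEmptyCount k)   ≡⟨ cong (totalGaps k +_) (sumTo-const m _) ⟩
    totalGaps k + m * (totalGaps k + nonEmptyCount k)             ≡⟨ collect m (totalGaps k) (nonEmptyCount k) ⟩
    q * totalGaps k + m * nonEmptyCount k                         ∎
    where
    open ≡-Reasoning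
    collect : ∀ m t n → t + m * (t + n) ≡ suc m * t + m * n
    collect = solve-∀

  -- Gaps of length g: the old ones, repeated in all m+1 copies, plus the newly created ones.
  gapsOfLength-suc : ∀ g k → gapsOfLength g (suc k) ≡ q * gapsOfLength g k + sumTo m (newGaps g k)
  gapsOfLength-suc g k = begin
    gapsOfLength g (suc k)                                        ≡⟨ sumOver-recursion (occurrences g ∘ gaps) (λ t ls → G ls + new t ls) k
                                                                       (λ t ls → occurrences-gaps-snoc g ls (idx k t)) ⟩
    gapsOfLength g k + sumTo m (λ t → sumOver (λ ls → G ls + new t ls) (upToBin k))
                                                                  ≡⟨ cong (gapsOfLength g k +_) (sumTo-cong m (λ t _ → sumOver-+ G (new t) (upToBin k))) ⟩
    gapsOfLength g k + sumTo m (λ t → gapsOfLength g k + newGaps g k t)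
                                                                  ≡⟨ cong (gapsOfLength g k +_) (sumTo-+ m (λ _ → gapsOfLength g k) (newGaps g k)) ⟩
    gapsOfLength g k + (sumTo m (λ _ → gapsOfLength g k) + sumTo m (newGaps g k))
                                                                  ≡⟨ cong (λ s → gapsOfLength g k + (s + sumTo m (newGaps g k))) (sumTo-const m _) ⟩
    gapsOfLength g k + (m * gapsOfLength g k + sumTo m (newGaps g k))
                                                                  ≡⟨ +-assoc (gapsOfLength g k) _ _ ⟨
    q * gapsOfLength g k + sumTo m (newGaps g k)                  ∎
    where
    open ≡-Reasoning
    G : List ℕ → ℕ
    G = occurrences g ∘ gaps
    new : ℕ → List ℕ → ℕ
    new t ls = occurrences g (map (idx k t ∸_) (lastOf ls))

  endingAt-suc : ∀ i k → endingAt i (suc k) ≡ endingAt i k + sumTo m (λ t → occurrences i (idx k t ∷ []) * count k)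
  endingAt-suc i k = trans (sumOver-recursion (occurrences i ∘ lastOf) (λ t _ → occurrences i (idx k t ∷ [])) k
                                              (λ t ls → cong (occurrences i) (lastOf-snoc ls (idx k t))))
                           (cong (endingAt i k +_) (sumTo-cong m (λ t _ → sumOver-const _ (upToBin k))))

  endingAt-beyond : ∀ i k → suc (m * k) ≤ i → endingAt i k ≡ 0
  endingAt-beyond i k mk<i = trans (sumOver-cong (occurrences i ∘ lastOf) (λ _ → 0) none (upToBin-bounded k))
                                   (sumOver-const 0 (upToBin k))
    where
    none : ∀ ls → All (_< suc (m * k)) ls → occurrences i (lastOf ls) ≡ 0
    none ls below = occurrences-below i (lastOf ls) (lastOf-All ls (All.map (λ x< → <-≤-trans x< mk<i) below))

  -- The decompositions ending at an index of bin b+1 are those of bins ≤ b extended by it.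
  endingAt-bin : ∀ b s k → s < m → b < k → endingAt (idx b s) k ≡ count b
  endingAt-bin b s k s<m b<k = subst (λ k → endingAt (idx b s) k ≡ count b) (m+[n∸m]≡n b<k) (later (k ∸ suc b))
    where
    i : ℕ
    i = idx b s
    idx-injective : ∀ t → idx b t ≡ i → t ≡ s
    idx-injective t eq = +-cancelˡ-≡ (m * b) t s (suc-injective eq)
    i<idx : ∀ k′ t → i < idx (suc b + k′) t
    i<idx k′ t = s≤s (<-≤-trans (+-monoʳ-< (m * b) s<m) (≤-trans (≤-reflexive (sym (*-suc′ m b)))
                       (≤-trans (*-monoʳ-≤ m (m≤m+n (suc b) k′)) (m≤m+n _ t))))
      where
      *-suc′ : ∀ m b → m * suc b ≡ m * b + m
      *-suc′ m b = trans (*-suc m b) (+-comm m (m * b))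
    later : ∀ k′ → endingAt i (suc b + k′) ≡ count b
    later zero rewrite +-identityʳ b = begin
      endingAt i (suc b)                                               ≡⟨ endingAt-suc i b ⟩
      endingAt i b + sumTo m (λ t → occurrences i (idx b t ∷ []) * count b)
                                                                       ≡⟨ cong₂ _+_ (endingAt-beyond i b (s≤s (m≤m+n (m * b) s)))
                                                                            (sumTo-single m s _ s<m (λ t _ t≢s →
                                                                              cong (_* count b) (occurrences-other i (idx b t) (t≢s ∘ idx-injective t)))) ⟩
      occurrences i (i ∷ []) * count b                                 ≡⟨ cong (_* count b) (occurrences-self i) ⟩
      1 * count b                                                      ≡⟨ *-identityˡ (count b) ⟩
      count b                                                          ∎
      where open ≡-Reasoning
    later (suc k′) rewrite +-suc b k′ = begin
      endingAt i (suc (suc b + k′))                                    ≡⟨ endingAt-suc i (suc b + k′) ⟩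
      endingAt i (suc b + k′) + sumTo m (λ t → occurrences i (idx (suc b + k′) t ∷ []) * count (suc b + k′))
                                                                       ≡⟨ cong₂ _+_ (later k′) (sumTo-zero m _ (λ t _ →
                                                                            cong (_* count (suc b + k′)) (occurrences-other i _ (≢-sym (<⇒≢ (i<idx k′ t)))))) ⟩
      count b + 0                                                      ≡⟨ +-identityʳ (count b) ⟩
      count b                                                          ∎
      where open ≡-Reasoning

  newGaps-endingAt : ∀ i g k t → i + g ≡ idx k t → newGaps g k t ≡ endingAt i k
  newGaps-endingAt i g k t i+g≡idx = sumOver-cong _ _ reflect (upToBin-bounded k)
    where
    reflect : ∀ ls → All (_< suc (m * k)) ls → occurrences g (map (idx k t ∸_) (lastOf ls)) ≡ occurrences i (lastOf ls)
    reflect ls below = occurrences-reflect i g (idx k t) (lastOf ls) i+g≡idx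
                         (lastOf-All ls (All.map (λ x< → ≤-trans (<⇒≤ x<) (s≤s (m≤m+n (m * k) t))) below))

  -- New gaps of length g = mα + β ending in bin α + k′ + 2.  For the first β indices of that bin
  -- the gap starts in bin k′+1, for the remaining ones in bin k′+2.
  newGaps-low : ∀ α β k′ t → β ≤ m → t < β → newGaps (m * α + β) (α + suc k′) t ≡ count k′
  newGaps-low α β k′ t β≤m t<β =
    trans (newGaps-endingAt (idx k′ s) _ _ t (starts m β (m ∸ β) α k′ t (sym (m∸n+n≡m β≤m))))
          (endingAt-bin k′ s (α + suc k′) s<m (m≤n+m (suc k′) α))
    where
    s : ℕ
    s = m ∸ β + t
    s<m : s < m
    s<m = subst (s <_) (m∸n+n≡m β≤m) (+-monoʳ-< (m ∸ β) t<β)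
    starts : ∀ M β d α k′ t → M ≡ d + β → suc (M * k′ + (d + t)) + (M * α + β) ≡ suc (M * (α + suc k′) + t)
    starts M β d α k′ t refl = identity β d α k′ t
      where
      identity : ∀ β d α k′ t → suc ((d + β) * k′ + (d + t)) + ((d + β) * α + β) ≡ suc ((d + β) * (α + suc k′) + t)
      identity = solve-∀

  newGaps-high : ∀ α β k′ t → β ≤ t → newGaps (m * α + β) (α + suc k′) t ≡ endingAt (idx (suc k′) (t ∸ β)) (α + suc k′)
  newGaps-high α β k′ t β≤t = newGaps-endingAt _ _ _ t (starts m (t ∸ β) β α k′ t (m∸n+n≡m β≤t))
    where
    starts : ∀ M u β α k′ t → u + β ≡ t → suc (M * suc k′ + u) + (M * α + β) ≡ suc (M * (α + suc k′) + t)
    starts M u β α k′ t refl = identity M u β α k′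
      where
      identity : ∀ M u β α k′ → suc (M * suc k′ + u) + (M * α + β) ≡ suc (M * (α + suc k′) + (u + β))
      identity = solve-∀

  -- Summing over the bin: for α = 0 only the first β indices create gaps of length β …
  newGaps-sum-zero : ∀ β k′ → β < m → sumTo m (newGaps (m * 0 + β) (suc k′)) ≡ β * count k′
  newGaps-sum-zero β k′ β<m = begin
    sumTo m (newGaps (m * 0 + β) (suc k′))   ≡⟨ sumTo-step m β (count k′) 0 _ (<⇒≤ β<m) (λ t → newGaps-low 0 β k′ t (<⇒≤ β<m)) high ⟩
    β * count k′ + (m ∸ β) * 0               ≡⟨ cong (β * count k′ +_) (*-zeroʳ (m ∸ β)) ⟩
    β * count k′ + 0                         ≡⟨ +-identityʳ (β * count k′) ⟩
    β * count k′                             ∎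
    where
    open ≡-Reasoning
    high : ∀ t → β ≤ t → t < m → newGaps (m * 0 + β) (suc k′) t ≡ 0
    high t β≤t _ = trans (newGaps-high 0 β k′ t β≤t) (endingAt-beyond _ (suc k′) (s≤s (m≤m+n (m * suc k′) (t ∸ β))))

  -- … while for α > 0 every index of the bin does.
  newGaps-sum-suc : ∀ α β k′ → β < m →
    sumTo m (newGaps (m * suc α + β) (suc α + suc k′)) ≡ β * count k′ + (m ∸ β) * count (suc k′)
  newGaps-sum-suc α β k′ β<m = sumTo-step m β (count k′) (count (suc k′)) _ (<⇒≤ β<m)
    (λ t → newGaps-low (suc α) β k′ t (<⇒≤ β<m))
    (λ t β≤t t<m → trans (newGaps-high (suc α) β k′ t β≤t)
                         (endingAt-bin (suc k′) (t ∸ β) (suc α + suc k′) (≤-<-trans (m∸n≤m t β) t<m) (s≤s (m≤n+m (suc k′) α))))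

length-concatMap-gaps : ∀ X → length (concatMap gaps X) ≡ sumOver gapCount X
length-concatMap-gaps []      = refl
length-concatMap-gaps (x ∷ X) = trans (length-++ (gaps x)) (cong (gapCount x +_) (length-concatMap-gaps X))

occurrences-concatMap-gaps : ∀ g X → occurrences g (concatMap gaps X) ≡ sumOver (occurrences g ∘ gaps) X
occurrences-concatMap-gaps g []      = refl
occurrences-concatMap-gaps g (x ∷ X) = trans (occurrences-++ g (gaps x) _) (cong (occurrences g (gaps x) +_) (occurrences-concatMap-gaps g X))

module Frequencies (m : ℕ) .{{m≢0 : NonZero m}} where

  open Bins m {{m≢0}}
  open GapStatistics m {{m≢0}}

  value-snoc : ∀ ls x → value m (ls ∷ʳ x) ≡ value m ls + a m x
  value-snoc ls x = trans (cong sum (map-++ (a m) ls (x ∷ [])))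
                          (trans (sum-++ (map (a m) ls) (a m x ∷ [])) (cong (value m ls +_) (+-identityʳ (a m x))))

  value-bound : ∀ k → All (λ ls → value m ls < 2 * q ^ k) (upToBin k)
  value-bound zero    rewrite upToBin-zero = s≤s z≤n ∷ s≤s (s≤s z≤n) ∷ []
  value-bound (suc k) = All-upToBin-suc k (All.map (λ v< → <-≤-trans v< (*-monoʳ-≤ 2 (m≤n*m (q ^ k) q))) (value-bound k))
                                          (λ t t<m → All.map (λ {ls} → extended t t<m {ls}) (value-bound k))
    where
    extended : ∀ t → t < m → ∀ {ls} → value m ls < 2 * q ^ k → value m (ls ∷ʳ idx k t) < 2 * q ^ suc k
    extended t t<m {ls} v< = begin-strict
      value m (ls ∷ʳ idx k t)             ≡⟨ trans (value-snoc ls (idx k t)) (cong (value m ls +_) (a-idx k t t<m)) ⟩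
      value m ls + 2 * (t + 1) * q ^ k    <⟨ +-monoˡ-< _ v< ⟩
      2 * q ^ k + 2 * (t + 1) * q ^ k     ≤⟨ +-monoʳ-≤ (2 * q ^ k) (*-monoˡ-≤ (q ^ k) (*-monoʳ-≤ 2 (subst (_≤ m) (+-comm 1 t) t<m))) ⟩
      2 * q ^ k + 2 * m * q ^ k           ≡⟨ collect m (q ^ k) ⟩
      2 * q ^ suc k                       ∎
      where
      open ≤-Reasoning
      collect : ∀ m x → 2 * x + 2 * m * x ≡ 2 * (suc m * x)
      collect = solve-∀

  a-top : ∀ n → a m (m * n + 1) ≡ 2 * q ^ n
  a-top n = trans (cong (a m) (trans (+-comm (m * n) 1) (cong suc (sym (+-identityʳ (m * n)))))) (a-idx n 0 (ℕ.>-nonZero⁻¹ m))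

  decomps-eq : ∀ n → decomps m n ≡ upToBin n
  decomps-eq n = filter-all _ (All.map (λ {ls} v< → subst (value m ls <_) (sym (a-top n)) v<) (value-bound n))

  P-eq : ∀ n g → P m n g ≡ ratio (gapsOfLength g n) (totalGaps n)
  P-eq n g = cong₂ ratio (trans (occurrences-concatMap-gaps g (decomps m n)) (cong (sumOver (occurrences g ∘ gaps)) (decomps-eq n)))
                         (trans (length-concatMap-gaps (decomps m n)) (cong (sumOver gapCount) (decomps-eq n)))

ConvergesTo-cong : ∀ {f g : ℕ → ℚ} {L} → (∀ n → f n ≡ g n) → ConvergesTo g L → ConvergesTo f L
ConvergesTo-cong {L = L} f≡g conv ε ε>0 with conv ε ε>0
... | N , close = N , λ n N≤n → subst (λ x → ∣ x - L ∣ <ℚ ε) (sym (f≡g n)) (close n N≤n)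

module Limits (m : ℕ) .{{m≢0 : NonZero m}} where

  open Bins m {{m≢0}}
  open GapStatistics m {{m≢0}}
  open Frequencies m {{m≢0}}

  gapFrequency-converges : ∀ g Lnum Lden K0 .{{_ : NonZero Lden}} →
    (∀ k → K0 ≤ k → sumTo m (newGaps g k) * Lden ≡ 2 * m * Lnum * q ^ k) →
    ConvergesTo (λ n → P m n g) (ℤ.+ Lnum ÷ Lden)
  gapFrequency-converges g Lnum Lden K0 rate = ConvergesTo-cong (λ n → P-eq n g)
    (Limit.converges m totalGaps nonEmptyCount totalGaps-suc (λ k → trans (nonEmptyCount-eq k) (count-eq k))
                     (gapsOfLength g) (λ k → sumTo m (newGaps g k)) (gapsOfLength-suc g) Lnum Lden K0 rate)

  newGaps-rate-zero : ∀ β k → β < m → 1 ≤ k → sumTo m (newGaps (m * 0 + β) k) * (m * q) ≡ 2 * m * β * q ^ k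
  newGaps-rate-zero β (suc k′) β<m _ = begin
    sumTo m (newGaps (m * 0 + β) (suc k′)) * (m * q)   ≡⟨ cong (_* (m * q)) (newGaps-sum-zero β k′ β<m) ⟩
    β * count k′ * (m * q)                             ≡⟨ cong (λ c → β * c * (m * q)) (count-eq k′) ⟩
    β * (2 * q ^ k′) * (m * q)                         ≡⟨ reorder β m q (q ^ k′) ⟩
    2 * m * β * (q * q ^ k′)                           ∎
    where
    open ≡-Reasoning
    reorder : ∀ β m q x → β * (2 * x) * (m * q) ≡ 2 * m * β * (q * x)
    reorder = solve-∀

  newGaps-rate-suc : ∀ α β k → β < m → suc (suc α) ≤ k →
    sumTo m (newGaps (m * suc α + β) k) * q ^ suc (suc α) ≡ 2 * m * (q ∸ β) * q ^ k
  newGaps-rate-suc α β k β<m K0≤k = subst (λ k → sumTo m (newGaps g k) * X ≡ 2 * m * (q ∸ β) * q ^ k)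
                                          k≡ (rate (k ∸ suc (suc α)))
    where
    g X d : ℕ
    g = m * suc α + β
    X = q ^ suc (suc α)
    d = m ∸ β
    d+β≡m : d + β ≡ m
    d+β≡m = m∸n+n≡m (<⇒≤ β<m)
    q∸β≡1+d : q ∸ β ≡ suc d
    q∸β≡1+d = +-∸-assoc 1 (<⇒≤ β<m)
    k≡ : suc α + suc (k ∸ suc (suc α)) ≡ k
    k≡ = trans (+-suc (suc α) _) (m+[n∸m]≡n K0≤k)
    identity : ∀ β d X Y → (β * (2 * Y) + d * (2 * (suc (d + β) * Y))) * X ≡ 2 * (d + β) * suc d * (X * Y)
    identity = solve-∀
    rate : ∀ k′ → sumTo m (newGaps g (suc α + suc k′)) * X ≡ 2 * m * (q ∸ β) * q ^ (suc α + suc k′)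
    rate k′ = begin
      sumTo m (newGaps g (suc α + suc k′)) * X                  ≡⟨ cong (_* X) (newGaps-sum-suc α β k′ β<m) ⟩
      (β * count k′ + d * count (suc k′)) * X                   ≡⟨ cong₂ (λ c c′ → (β * c + d * c′) * X) (count-eq k′) (count-eq (suc k′)) ⟩
      (β * (2 * Y) + d * (2 * (suc m * Y))) * X                 ≡⟨ cong (λ M → (β * (2 * Y) + d * (2 * (suc M * Y))) * X) (sym d+β≡m) ⟩
      (β * (2 * Y) + d * (2 * (suc (d + β) * Y))) * X           ≡⟨ identity β d X Y ⟩
      2 * (d + β) * suc d * (X * Y)                             ≡⟨ cong₂ (λ M e → 2 * M * e * (X * Y)) d+β≡m (sym q∸β≡1+d) ⟩
      2 * m * (q ∸ β) * (X * Y)                                 ≡⟨ cong (2 * m * (q ∸ β) *_) (sym (^-distribˡ-+-* q (suc (suc α)) k′)) ⟩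
      2 * m * (q ∸ β) * q ^ (suc (suc α) + k′)                  ≡⟨ cong (λ e → 2 * m * (q ∸ β) * q ^ e) (sym (+-suc (suc α) k′)) ⟩
      2 * m * (q ∸ β) * q ^ (suc α + suc k′)                    ∎
      where
      open ≡-Reasoning
      Y : ℕ
      Y = q ^ k′

-- Theorem 1.4.  For α = 0 the creation rate is exact from bin 1 on, for α > 0 from bin α + 1 on.
theorem1p4 : (m : ℕ) → .{{_ : NonZero m}} → (α β : ℕ) → β < m → 1 ≤ m * α + β →
    ConvergesTo (λ n → P m n (m * α + β)) (limitValue m α β)
theorem1p4 m zero    β β<m _ = gapFrequency-converges (m * 0 + β) β (m * suc m) 1 {{m*n≢0 m (suc m)}}
                                   (λ k 1≤k → newGaps-rate-zero β k β<m 1≤k)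
  where open Limits m
theorem1p4 m (suc α) β β<m _ = gapFrequency-converges (m * suc α + β) (suc m ∸ β) (suc m ^ suc (suc α)) (suc (suc α))
                                   {{m^n≢0 (suc m) (suc (suc α))}} (λ k K0≤k → newGaps-rate-suc α β k β<m K0≤k)
  where open Limits m
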